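{- Let $3\le k_1<k_2$ be integers and $n$ a positive integer. If $\nu_{k_1}(n+k_1-3)>0$, then $\nu_{k_2}(n+k_2-3)>0$.
   Context: For an integer $k\ge 3$ and a positive integer $m$, $\nu_k(m)$ denotes the number of $k$-tuples of integers $(x_1,\dots,x_k)$ with $1\le x_1\le x_2\le\dots\le x_k$ such that $m = x_1x_2\cdots x_k + x_1+x_2+\dots+x_k$. -}

module Defs where

open import Data.Nat using (ℕ; zero; suc; _+_; _*_; _≤_; _≤?_; _≟_)
open import Data.List using (List; []; _∷_; length; filter; map; concatMap; upTo)
open import Data.Nat.ListAction using (sum; product)
open import Data.List.Relation.Unary.All using (All)
open import Data.List.Relation.Unary.Linked using (Linked)
import Data.List.Relation.Unary.All as All
import Data.List.Relation.Unary.Linked as Linked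
open import Relation.Nullary using (Dec)
open import Relation.Nullary.Decidable using (_×-dec_)
open import Data.Product using (_×_)
open import Relation.Binary.PropositionalEquality using (_≡_)

lists : ℕ → ℕ → List (List ℕ)
lists zero    m = [] ∷ []
lists (suc k) m = concatMap (λ x → map (x ∷_) (lists k m)) (map suc (upTo m))

IsSolution : ℕ → List ℕ → Set
IsSolution m xs = All (1 ≤_) xs × Linked _≤_ xs × (m ≡ product xs + sum xs)

isSolution? : ∀ m xs → Dec (IsSolution m xs)
isSolution? m xs = All.all? (1 ≤?_) xs ×-dec (Linked.linked? _≤?_ xs ×-dec (m ≟ product xs + sum xs))

-- ν k m : number of k-tuples 1 ≤ x_1 ≤ ... ≤ x_k with m = ∏ x_i + ∑ x_i.
-- Any such tuple has every x_i ≤ ∑ x_i ≤ m, so enumerating entries in {1,...,m}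
-- counts all of them (each exactly once).
ν : ℕ → ℕ → ℕ
ν k m = length (filter (isSolution? m) (lists k m))

{-# OPTIONS --safe #-}
module Submission where

-- Prepending the entry 1 to a solution for m leaves the product unchanged and
-- raises the sum by one, so it gives a solution with k + 1 entries for m + 1.
-- Since n + k ∸ 3 grows by one together with k, this step carries a solution
-- for k₁ all the way up to k₂.

open import Defs
open import Data.Nat using (ℕ; suc; _+_; _∸_; _≤_; _<_; _≤′_; ≤′-refl; ≤′-step; z≤n; s≤s)
open import Data.Nat.Properties
  using (+-identityʳ; +-suc; +-∸-assoc; ≤-trans; m≤n+m; m<n⇒m<1+n; ≤⇒≤′; ≤′⇒≤; <⇒≤)
open import Data.List using (List; []; _∷_; length; map; upTo)
open import Data.Nat.ListAction using (sum; product)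
open import Data.List.Membership.Propositional using (_∈_; find; lose)
open import Data.List.Membership.Propositional.Properties
  using (∈-concatMap⁺; ∈-concatMap⁻; ∈-map⁺; ∈-map⁻; ∈-upTo⁺; ∈-upTo⁻; ∈-filter⁺; ∈-filter⁻; ∈-length)
open import Data.List.Relation.Unary.Any using (here)
open import Data.List.Relation.Unary.All using (_∷_)
open import Data.List.Relation.Unary.Linked using ([-]; _∷_)
open import Data.Product using (_,_; ∃)
open import Relation.Binary.PropositionalEquality using (_≡_; refl; sym; trans; cong; subst; module ≡-Reasoning)

lists-mono : ∀ k m {xs} → xs ∈ lists k m → xs ∈ lists k (suc m)
lists-mono 0       m p = p
lists-mono (suc k) m p
  with x , x∈ , xs∈ ← find (∈-concatMap⁻ (λ x → map (x ∷_) (lists k m)) {xs = map suc (upTo m)} p)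
  with i , i∈ , refl ← ∈-map⁻ suc x∈
  with ys , ys∈ , refl ← ∈-map⁻ (x ∷_) xs∈
  = ∈-concatMap⁺ (λ x → map (x ∷_) (lists k (suc m)))
      (lose (∈-map⁺ suc (∈-upTo⁺ (m<n⇒m<1+n (∈-upTo⁻ i∈))))
            (∈-map⁺ (suc i ∷_) (lists-mono k m ys∈)))

1∷-∈-lists : ∀ k m {xs} → xs ∈ lists k m → (1 ∷ xs) ∈ lists (suc k) (suc m)
1∷-∈-lists k m p =
  ∈-concatMap⁺ (λ x → map (x ∷_) (lists k (suc m)))
    (lose (∈-map⁺ suc (∈-upTo⁺ {n = suc m} (s≤s z≤n))) (∈-map⁺ (1 ∷_) (lists-mono k m p)))

1∷-isSolution : ∀ m xs → IsSolution m xs → IsSolution (suc m) (1 ∷ xs)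
1∷-isSolution m []       (pos , sorted , eq) = (s≤s z≤n ∷ pos) , [-] , cong suc eq
1∷-isSolution m (x ∷ xs) (pos@(1≤x ∷ _) , sorted , eq) =
  (s≤s z≤n ∷ pos) , (1≤x ∷ sorted) , trans (cong suc eq) (product-sum-1∷ (product (x ∷ xs)) (sum (x ∷ xs)))
  where
  product-sum-1∷ : ∀ p s → suc (p + s) ≡ (p + 0) + suc s
  product-sum-1∷ p s rewrite +-identityʳ p = sym (+-suc p s)

length>0⇒∈ : ∀ {A : Set} {ys : List A} → 0 < length ys → ∃ (_∈ ys)
length>0⇒∈ {ys = y ∷ _} _ = y , here refl

ν-suc-pos : ∀ k m → 0 < ν k m → 0 < ν (suc k) (suc m)
ν-suc-pos k m ν>0
  with xs , xs∈ ← length>0⇒∈ ν>0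
  with xs∈lists , sol ← ∈-filter⁻ (isSolution? m) xs∈
  = ∈-length (∈-filter⁺ (isSolution? (suc m)) (1∷-∈-lists k m xs∈lists) (1∷-isSolution m xs sol))

+-∸-suc : ∀ n k {c} → c ≤ k → n + suc k ∸ c ≡ suc (n + k ∸ c)
+-∸-suc n k {c} c≤k = begin
  n + suc k ∸ c   ≡⟨ cong (_∸ c) (+-suc n k) ⟩
  suc (n + k) ∸ c ≡⟨ +-∸-assoc 1 (≤-trans c≤k (m≤n+m k n)) ⟩
  suc (n + k ∸ c) ∎
  where open ≡-Reasoning

ν-pos-mono : ∀ n c {k₁ k₂} → c ≤ k₁ → k₁ ≤′ k₂ → 0 < ν k₁ (n + k₁ ∸ c) → 0 < ν k₂ (n + k₂ ∸ c)
ν-pos-mono n c c≤k₁ ≤′-refl ν>0 = ν>0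
ν-pos-mono n c {k₂ = suc k} c≤k₁ (≤′-step k₁≤′k) ν>0 =
  subst (λ m → 0 < ν (suc k) m) (sym (+-∸-suc n k (≤-trans c≤k₁ (≤′⇒≤ k₁≤′k))))
    (ν-suc-pos k _ (ν-pos-mono n c c≤k₁ k₁≤′k ν>0))

corollary1 : (k₁ k₂ n : ℕ) → 3 ≤ k₁ → k₁ < k₂ → 1 ≤ n →
    0 < ν k₁ (n + k₁ ∸ 3) → 0 < ν k₂ (n + k₂ ∸ 3)
corollary1 k₁ k₂ n 3≤k₁ k₁<k₂ _ = ν-pos-mono n 3 3≤k₁ (≤⇒≤′ (<⇒≤ k₁<k₂))
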